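{- Let $G$ be an acyclic digraph, let $d\ge 1$ and $k>3d$ be integers, and let $I=\{(s_1,t_1),\dots,(s_k,t_k)\}\subseteq V(G)\times V(G)$ be a set of $k$ pairs. Then there exists a $(k-d)$-routing of $I$ in $G$ if and only if for every pair $(s,t)\in I$ there is a path in $G$ from $s$ to $t$ and there is a subset $I'\subsetneq I$ with $|I'|=k-1$ such that there is a $(k-d-1)$-routing of $I'$ in $G$.
   Context: Digraphs have no loops. A path in a digraph $G$ is a sequence $(v_1,\dots,v_\ell)$ of pairwise distinct vertices with $(v_i,v_{i+1})\in E(G)$ for all $1\le i<\ell$; it links $v_1$ to $v_\ell$. Given a digraph $G$, a set $J=\{(s_1,t_1),\dots,(s_m,t_m)\}$ of pairs of vertices and an integer $c$, a $c$-routing of $J$ is a set $\{P_1,\dots,P_m\}$ of paths such that $P_i$ links $s_i$ to $t_i$ for all $i$, and no vertex of $G$ lies on more than $c$ of the paths. -}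

module Defs where

open import Data.Nat using (ℕ; suc; _≤_)
open import Data.Fin using (Fin; _≟_)
open import Data.List using (List; []; _∷_; length; filter; allFin)
open import Data.List.Relation.Unary.Unique.Propositional using (Unique)
open import Data.List.Membership.Propositional using (_∈_)
open import Data.Product using (Σ; _×_; _,_; proj₁; proj₂)
open import Data.Unit using (⊤)
open import Data.Empty using (⊥)
open import Relation.Nullary using (¬_)
open import Relation.Binary.PropositionalEquality using (_≡_)
open import Function.Definitions using (Injective)

record Digraph : Set₁ where
  field
    n      : ℕ
    E      : Fin n → Fin n → Set
    noLoop : ∀ v → ¬ E v v

open Digraph public

V : Digraph → Set
V G = Fin (n G)

Consecutive : (G : Digraph) → List (V G) → Set
Consecutive G []           = ⊤
Consecutive G (x ∷ [])     = ⊤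
Consecutive G (x ∷ y ∷ xs) = E G x y × Consecutive G (y ∷ xs)

IsPath : (G : Digraph) → List (V G) → Set
IsPath G vs = Unique vs × Consecutive G vs

FirstIs : {A : Set} → List A → A → Set
FirstIs []       a = ⊥
FirstIs (x ∷ xs) a = x ≡ a

LastIs : {A : Set} → List A → A → Set
LastIs []           a = ⊥
LastIs (x ∷ [])     a = x ≡ a
LastIs (x ∷ y ∷ xs) a = LastIs (y ∷ xs) a

Links : (G : Digraph) → List (V G) → V G → V G → Set
Links G vs s t = IsPath G vs × FirstIs vs s × LastIs vs t

-- G has a directed cycle: a path (v₁,…,vₗ) with l ≥ 2 and an edge vₗ → v₁
-- (loops are excluded, so this is the usual notion of a cycle)
HasCycle : Digraph → Set
HasCycle G = Σ (List (V G)) λ vs → Σ (V G) λ a → Σ (V G) λ b →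
  IsPath G vs × 2 ≤ length vs × FirstIs vs a × LastIs vs b × E G b a

Acyclic : Digraph → Set
Acyclic G = ¬ HasCycle G

load : (G : Digraph) {m : ℕ} → (Fin m → List (V G)) → V G → ℕ
load G {m} P v = length (filter (λ i → v ∈? P i) (allFin m))
  where open import Data.List.Membership.DecPropositional (_≟_ {n G}) using (_∈?_)

Routing : (G : Digraph) {m : ℕ} → (Fin m → V G × V G) → ℕ → Set
Routing G {m} I c = Σ (Fin m → List (V G)) λ P →
  (∀ i → Links G (P i) (Data.Product.proj₁ (I i)) (Data.Product.proj₂ (I i)))
  × (∀ v → load G P v ≤ c)

PathExists : (G : Digraph) → V G → V G → Set
PathExists G s t = Σ (List (V G)) λ vs → Links G vs s t

module Submission where

-- Let t = k ∸ d, so that 3t > 2k. In a t-routing call a vertex heavy if its load is t.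
-- By pigeonhole any three heavy vertices lie on a common path, so (G being acyclic) the
-- heavy vertices are totally ordered by reachability. Exchanging two segments with the
-- same endpoints between two paths changes no load. If a heavy vertex h misses path c,
-- either h lies outside the stretch of c between its first and last heavy vertices, and
-- this stretch is exchanged into a path through h, or h falls between two consecutive
-- heavy vertices x, y of c, and the stretch x…y of c is exchanged with the x…y stretch of
-- a path through x, h, y. Repeating this puts every heavy vertex on one path; deleting it
-- leaves a (t ∸ 1)-routing of the other k ∸ 1 pairs. Conversely, adding any path for the
-- missing pair to a (t ∸ 1)-routing of k ∸ 1 pairs gives a t-routing.

open import Defs
open import Level using (_⊔_)
open import Data.Bool using (true; false)
open import Data.Nat using (ℕ; zero; suc; _+_; _*_; _∸_; _≤_; _<_; z≤n; s≤s; _≤?_; _<?_)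
open import Data.Nat.Properties
  using ( module ≤-Reasoning; +-0-commutativeMonoid; +-assoc; +-mono-≤; +-monoˡ-≤; +-monoʳ-<
        ; +-cancelˡ-<; +-cancelʳ-<; ≤-refl; ≤-trans; <-≤-trans; ≤-<-trans; <⇒≤; ≤⇒≯; ≮⇒≥; ≰⇒>
        ; 1+n≰n; m≤n+m; m≤n*m; m∸n+n≡m; m<n⇒0<n∸m )
open import Data.Nat.Solver using (module +-*-Solver)
open import Data.Fin using (Fin; zero; suc; punchIn; punchOut; _≟_)
open import Data.Fin.Properties as Finₚ
  using (¬∀⟶∃¬; injective⇒≤; punchIn-injective; punchOut-injective; punchIn-punchOut; punchInᵢ≢i)
open import Data.Fin.Permutation
  using (Permutation′; permutation; _⟨$⟩ʳ_; _⟨$⟩ˡ_; inverseˡ; inverseʳ)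
open import Data.Vec.Functional as Vector using (updateAt)
open import Data.Vec.Functional.Properties using (updateAt-updates; updateAt-minimal)
open import Data.List using (List; []; _∷_; _++_; [_]; length; filter; tabulate; allFin)
open import Data.List.Properties using (++-assoc; length-++; filter-++; filter-accept; filter-reject)
open import Data.List.Relation.Unary.Any as Any using (Any; here; there)
open import Data.List.Relation.Unary.All as All using (All; []; _∷_)
open import Data.List.Relation.Unary.All.Properties using (¬Any⇒All¬; ++⁺; ++⁻ˡ)
open import Data.List.Relation.Unary.AllPairs using ([]; _∷_)
open import Data.List.Relation.Unary.Unique.Propositional using (Unique)
open import Data.List.Membership.Propositional using (_∈_; _∉_; lose)
open import Data.List.Membership.Propositional.Properties
  using (∈-∃++; ∈-++⁻; ∈-++⁺ˡ; ∈-++⁺ʳ; ∈-allFin)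
open import Data.Product using (Σ; ∃; _×_; _,_; proj₁; proj₂; map; map₂)
open import Data.Sum using (_⊎_; inj₁; inj₂; [_,_]′)
open import Data.Unit using (tt)
open import Data.Empty using (⊥)
open import Function using (_∘_; id; const; _⇔_; mk⇔; Equivalence)
open import Function.Definitions using (Injective)
open import Relation.Nullary using (¬_; Dec; yes; no; _because_; contradiction)
open import Relation.Unary using (Pred; Decidable; ∁)
open import Relation.Binary.Definitions using (DecidableEquality)
open import Relation.Binary.Construct.Closure.ReflexiveTransitive using (Star; ε; _◅_; _◅◅_)
open import Relation.Binary.PropositionalEquality hiding ([_])
open import Algebra.Properties.CommutativeMonoid.Sum +-0-commutativeMonoid
  using (sum; sum-remove; sum-cong-≗; sum-permute; ∑-distrib-+)

-- Counting

indicator : ∀ {p} {P : Set p} → Dec P → ℕ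
indicator (true  because _) = 1
indicator (false because _) = 0

module _ {p} {P : Set p} where

  indicator≤1 : (P? : Dec P) → indicator P? ≤ 1
  indicator≤1 (yes _) = s≤s z≤n
  indicator≤1 (no _)  = z≤n

  indicator-yes : (P? : Dec P) → P → indicator P? ≡ 1
  indicator-yes (yes _) _ = refl
  indicator-yes (no ¬p) p = contradiction p ¬p

  indicator-no : (P? : Dec P) → ¬ P → indicator P? ≡ 0
  indicator-no (yes p) ¬p = contradiction p ¬p
  indicator-no (no _)  _  = refl

indicator-cong : ∀ {p q} {P : Set p} {Q : Set q} (P? : Dec P) (Q? : Dec Q) → P ⇔ Q →
  indicator P? ≡ indicator Q?
indicator-cong (yes _) (yes _) _   = refl
indicator-cong (no _)  (no _)  _   = refl
indicator-cong (yes p) (no ¬q) P⇔Q = contradiction (Equivalence.to P⇔Q p) ¬q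
indicator-cong (no ¬p) (yes q) P⇔Q = contradiction (Equivalence.from P⇔Q q) ¬p

indicators>2⇒all : ∀ {a b c} {A : Set a} {B : Set b} {C : Set c}
  (A? : Dec A) (B? : Dec B) (C? : Dec C) →
  2 < indicator A? + indicator B? + indicator C? → A × B × C
indicators>2⇒all (yes a) (yes b) (yes c) _                 = a , b , c
indicators>2⇒all (yes _) (yes _) (no _)  (s≤s (s≤s ()))
indicators>2⇒all (yes _) (no _)  C?      (s≤s 2≤C)         = contradiction 2≤C (≤⇒≯ (indicator≤1 C?))
indicators>2⇒all (no _)  B?      C?      2<B+C             =
  contradiction 2<B+C (≤⇒≯ (+-mono-≤ (indicator≤1 B?) (indicator≤1 C?)))

length-filter-tabulate : ∀ {a p} {A : Set a} {P : Pred A p} (P? : Decidable P) {m} (f : Fin m → A) →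
  length (filter P? (tabulate f)) ≡ sum (λ i → indicator (P? (f i)))
length-filter-tabulate P? {zero}  f = refl
length-filter-tabulate P? {suc m} f with P? (f zero)
... | true  because _ = cong suc (length-filter-tabulate P? (f ∘ suc))
... | false because _ = length-filter-tabulate P? (f ∘ suc)

∑-pigeonhole : ∀ {m} b (f : Fin m → ℕ) → m * b < sum f → ∃ λ i → b < f i
∑-pigeonhole {suc m} b f m*b<∑f with b <? f zero
... | yes b<f₀ = zero , b<f₀
... | no  b≮f₀ = map suc id (∑-pigeonhole b (f ∘ suc) rest)
  where
  rest : m * b < sum (f ∘ suc)
  rest = +-cancelˡ-< b _ _ (<-≤-trans m*b<∑f (+-monoˡ-≤ _ (≮⇒≥ b≮f₀)))

∑-remove-pair : ∀ {m} (f : Fin (suc (suc m)) → ℕ) {c b} (c≢b : c ≢ b) →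
  sum f ≡ f c + f b + sum (f ∘ punchIn c ∘ punchIn (punchOut c≢b))
∑-remove-pair {m} f {c} {b} c≢b = begin
  sum f                                ≡⟨ sum-remove {i = c} f ⟩
  f c + sum (f ∘ punchIn c)            ≡⟨ cong (f c +_) (sum-remove {i = b′} (f ∘ punchIn c)) ⟩
  f c + (f (punchIn c b′) + sum rest)  ≡⟨ cong (λ j → f c + (f j + sum rest)) (punchIn-punchOut c≢b) ⟩
  f c + (f b + sum rest)               ≡⟨ +-assoc (f c) (f b) _ ⟨
  f c + f b + sum rest                 ∎
  where
  open ≡-Reasoning
  b′ : Fin (suc m)
  b′ = punchOut c≢b
  rest : Fin m → ℕ
  rest = f ∘ punchIn c ∘ punchIn b′

∑-cong-outside-pair : ∀ {m} {f g : Fin m → ℕ} {c b : Fin m} → c ≢ b →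
  (∀ i → i ≢ c → i ≢ b → f i ≡ g i) → f c + f b ≡ g c + g b → sum f ≡ sum g
∑-cong-outside-pair {suc zero} {c = zero} {zero} c≢b _ _ = contradiction refl c≢b
∑-cong-outside-pair {suc (suc m)} {f} {g} {c} {b} c≢b outside pair = begin
  sum f                                         ≡⟨ ∑-remove-pair f c≢b ⟩
  f c + f b + sum (f ∘ punchIn c ∘ punchIn b′)  ≡⟨ cong₂ _+_ pair (sum-cong-≗ rest) ⟩
  g c + g b + sum (g ∘ punchIn c ∘ punchIn b′)  ≡⟨ ∑-remove-pair g c≢b ⟨
  sum g                                         ∎
  where
  open ≡-Reasoning
  b′ : Fin (suc m)
  b′ = punchOut c≢b
  rest : ∀ y → f (punchIn c (punchIn b′ y)) ≡ g (punchIn c (punchIn b′ y))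
  rest y = outside _ (punchInᵢ≢i c _) λ eq →
    punchInᵢ≢i b′ y (punchIn-injective c _ _ (trans eq (sym (punchIn-punchOut c≢b))))

-- Injections between finite sets

injective⇒surjective : ∀ {n} {f : Fin n → Fin n} → Injective _≡_ _≡_ f → ∀ y → ∃ λ x → f x ≡ y
injective⇒surjective {suc n} {f} f-inj y with Finₚ.any? (λ x → f x ≟ y)
... | yes hit = hit
... | no ¬hit = contradiction (injective⇒≤ skip-injective) 1+n≰n
  where
  skip : Fin (suc n) → Fin n
  skip x = punchOut {i = y} λ y≡fx → ¬hit (x , sym y≡fx)
  skip-injective : Injective _≡_ _≡_ skip
  skip-injective eq = f-inj (punchOut-injective {i = y} _ _ eq)

injective⇒permutation : ∀ {n} (f : Fin n → Fin n) → Injective _≡_ _≡_ f → Permutation′ n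
injective⇒permutation f f-inj =
  permutation f (proj₁ ∘ onto) (proj₂ ∘ onto) (λ x → f-inj (proj₂ (onto (f x))))
  where
  onto : ∀ y → ∃ λ x → f x ≡ y
  onto = injective⇒surjective f-inj

missed-point : ∀ {m} {f : Fin m → Fin (suc m)} → Injective _≡_ _≡_ f → ∃ λ j → ∀ x → f x ≢ j
missed-point {m} {f} f-inj =
  map₂ (λ ¬hit x fx≡j → ¬hit (x , fx≡j))
       (¬∀⟶∃¬ (suc m) _ (λ j → Finₚ.any? (λ x → f x ≟ j)) not-onto)
  where
  not-onto : ¬ (∀ j → ∃ λ x → f x ≡ j)
  not-onto hit = 1+n≰n (injective⇒≤ {f = proj₁ ∘ hit} λ {i} {j} eq →
    trans (sym (proj₂ (hit i))) (trans (cong f eq) (proj₂ (hit j))))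

cons-injective : ∀ {m} {j} {f : Fin m → Fin (suc m)} → (∀ x → f x ≢ j) → Injective _≡_ _≡_ f →
  Injective _≡_ _≡_ (j Vector.∷ f)
cons-injective missed f-inj {zero}  {zero}  eq = refl
cons-injective missed f-inj {zero}  {suc y} eq = contradiction (sym eq) (missed y)
cons-injective missed f-inj {suc x} {zero}  eq = contradiction eq (missed x)
cons-injective missed f-inj {suc x} {suc y} eq = cong suc (f-inj eq)

-- Segments of lists

module _ {A : Set} where

  last-++⁺ : ∀ xs {ys} {w : A} → LastIs ys w → LastIs (xs ++ ys) w
  last-++⁺ []            l = l
  last-++⁺ (x ∷ [])      {y ∷ ys} l = l
  last-++⁺ (x ∷ x′ ∷ xs) l = last-++⁺ (x′ ∷ xs) l

  last-∷ʳ : ∀ xs (w : A) → LastIs (xs ++ [ w ]) w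
  last-∷ʳ xs w = last-++⁺ xs refl

  last-∈ : ∀ {xs} {w : A} → LastIs xs w → w ∈ xs
  last-∈ {x ∷ []}     refl = here refl
  last-∈ {x ∷ y ∷ xs} l    = there (last-∈ l)

  ∈-++₃⁻ : ∀ xs {ys zs} {v : A} → v ∈ xs ++ ys ++ zs → v ∈ xs ⊎ v ∈ ys ⊎ v ∈ zs
  ∈-++₃⁻ xs {ys} v∈ with ∈-++⁻ xs v∈
  ... | inj₁ v∈xs     = inj₁ v∈xs
  ... | inj₂ v∈ys++zs = inj₂ (∈-++⁻ ys v∈ys++zs)

  ∈-++-middle⁺ : ∀ xs {ys zs} {v : A} → v ∈ ys → v ∈ xs ++ ys ++ zs
  ∈-++-middle⁺ xs v∈ys = ∈-++⁺ʳ xs (∈-++⁺ˡ v∈ys)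

  ∈-++-replace-middle : ∀ xs {ys ys′ zs} {v : A} →
    v ∈ xs ++ ys ++ zs → (v ∈ ys → v ∈ ys′) → v ∈ xs ++ ys′ ++ zs
  ∈-++-replace-middle xs {ys′ = ys′} v∈ ys⇒ys′ with ∈-++₃⁻ xs v∈
  ... | inj₁ v∈xs        = ∈-++⁺ˡ v∈xs
  ... | inj₂ (inj₁ v∈ys) = ∈-++-middle⁺ xs (ys⇒ys′ v∈ys)
  ... | inj₂ (inj₂ v∈zs) = ∈-++⁺ʳ xs (∈-++⁺ʳ ys′ v∈zs)

  record Segment (L : List A) (u w : A) : Set where
    field
      pre inner post : List A
      ends  : LastIs (u ∷ inner) w
      split : L ≡ pre ++ (u ∷ inner) ++ post

  open Segment public

  middle : ∀ {L} {u w : A} → Segment L u w → List A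
  middle {u = u} σ = u ∷ inner σ

  ∈-segment⁻ : ∀ {L} {u w v : A} (σ : Segment L u w) → v ∈ L →
    v ∈ pre σ ⊎ v ∈ middle σ ⊎ v ∈ post σ
  ∈-segment⁻ σ v∈L = ∈-++₃⁻ (pre σ) (subst (_ ∈_) (split σ) v∈L)

  ∈-middle⁺ : ∀ {L} {u w v : A} (σ : Segment L u w) → v ∈ middle σ → v ∈ L
  ∈-middle⁺ σ v∈ = subst (_ ∈_) (sym (split σ)) (∈-++-middle⁺ (pre σ) v∈)

  segment-prepend : ∀ xs {L} {u w : A} → Segment L u w → Segment (xs ++ L) u w
  segment-prepend xs σ = record
    { pre = xs ++ pre σ ; inner = inner σ ; post = post σ ; ends = ends σ
    ; split = trans (cong (xs ++_) (split σ)) (sym (++-assoc xs (pre σ) _)) }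

  segment-or-reverse : ∀ {L} {u w : A} → u ∈ L → w ∈ L → Segment L u w ⊎ Segment L w u
  segment-or-reverse {u = u} {w} u∈L w∈L with ys , zs , refl ← ∈-∃++ u∈L with ∈-++⁻ ys w∈L
  ... | inj₁ w∈ys with ys₁ , ys₂ , refl ← ∈-∃++ w∈ys = inj₂ (record
    { pre = ys₁ ; inner = ys₂ ++ [ u ] ; post = zs ; ends = last-∷ʳ (w ∷ ys₂) u
    ; split = trans (++-assoc ys₁ (w ∷ ys₂) (u ∷ zs))
                    (cong (λ l → ys₁ ++ w ∷ l) (sym (++-assoc ys₂ [ u ] zs))) })
  ... | inj₂ (here refl) = inj₁ (record { pre = ys ; inner = [] ; post = zs ; ends = refl ; split = refl })
  ... | inj₂ (there w∈zs) with zs₁ , zs₂ , refl ← ∈-∃++ w∈zs = inj₁ (record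
    { pre = ys ; inner = zs₁ ++ [ w ] ; post = zs₂ ; ends = last-∷ʳ (u ∷ zs₁) w
    ; split = cong (λ l → ys ++ u ∷ l) (sym (++-assoc zs₁ [ w ] zs₂)) })

  module _ {p} {P : Pred A p} (P? : Decidable P) where

    outermost-segment : ∀ {L} → Any P L →
      Σ A λ u → Σ A λ w → Σ (Segment L u w) λ σ →
        P u × P w × All (∁ P) (pre σ) × All (∁ P) (post σ)
    outermost-segment {x ∷ L} P[x∷L] with P? x | Any.any? P? L
    ... | yes px | no ¬P[L] =
      x , x , record { pre = [] ; inner = [] ; post = L ; ends = refl ; split = refl } ,
      px , px , [] , ¬Any⇒All¬ L ¬P[L]
    ... | yes px | yes P[L] with u , w , σ , _ , pw , _ , ¬P[post] ← outermost-segment P[L] =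
      x , w , record { pre = [] ; inner = pre σ ++ u ∷ inner σ ; post = post σ
                     ; ends = last-++⁺ (x ∷ pre σ) (ends σ)
                     ; split = cong (x ∷_) (trans (split σ) (sym (++-assoc (pre σ) _ _))) } ,
      px , pw , [] , ¬P[post]
    ... | no ¬px | _ with P[x∷L]
    ...   | here px    = contradiction px ¬px
    ...   | there P[L] with u , w , σ , pu , pw , ¬P[pre] , ¬P[post] ← outermost-segment P[L] =
      u , w , segment-prepend [ x ] σ , pu , pw , ¬px ∷ ¬P[pre] , ¬P[post]

    module _ {q r} {Q : Pred A q} {R : Pred A r} where

      Crossing : List A → Set (p ⊔ q ⊔ r)
      Crossing L = Σ A λ x → Σ A λ y → Σ (Segment L x y) λ σ →
        P x × P y × Q x × R y × (∀ v → v ∈ middle σ → P v → v ≡ x ⊎ v ≡ y)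

      crossing-prepend : ∀ xs {L} → Crossing L → Crossing (xs ++ L)
      crossing-prepend xs (x , y , σ , rest) = x , y , segment-prepend xs σ , rest

      adjacent-crossing : ∀ x N t T → P x → Q x → All (∁ P) N → P t → R t →
        Crossing (x ∷ N ++ t ∷ T)
      adjacent-crossing x N t T px qx ¬P[N] pt rt =
        x , t , record { pre = [] ; inner = N ++ [ t ] ; post = T ; ends = last-∷ʳ (x ∷ N) t
                       ; split = cong (x ∷_) (sym (++-assoc N [ t ] T)) } ,
        px , pt , qx , rt , endpoints
        where
        endpoints : ∀ v → v ∈ x ∷ N ++ [ t ] → P v → v ≡ x ⊎ v ≡ t
        endpoints v (here refl) _  = inj₁ refl
        endpoints v (there v∈) pv with ∈-++⁻ N v∈
        ... | inj₁ v∈N         = contradiction pv (All.lookup ¬P[N] v∈N)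
        ... | inj₂ (here refl) = inj₂ refl

      crossing : ∀ x N T → P x → Q x → All (∁ P) N →
        (∀ v → v ∈ T → P v → Q v ⊎ R v) → Any (λ z → P z × R z) T → Crossing (x ∷ N ++ T)
      crossing x N (t ∷ T) px qx ¬P[N] classify P∩R[t∷T] with P? t
      ... | no ¬pt = subst (Crossing ∘ (x ∷_)) (++-assoc N [ t ] T)
            (crossing x (N ++ [ t ]) T px qx (++⁺ ¬P[N] (¬pt ∷ [])) (λ v → classify v ∘ there)
                      (skip P∩R[t∷T]))
        where
        skip : Any (λ z → P z × R z) (t ∷ T) → Any (λ z → P z × R z) T
        skip (here (pt , _)) = contradiction pt ¬pt
        skip (there found)   = found
      ... | yes pt with P∩R[t∷T] | classify t (here refl) pt
      ...   | here (_ , rt) | _       = adjacent-crossing x N t T px qx ¬P[N] pt rt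
      ...   | there _       | inj₂ rt = adjacent-crossing x N t T px qx ¬P[N] pt rt
      ...   | there P∩R[T]  | inj₁ qt =
            crossing-prepend (x ∷ N) (crossing t [] T pt qt [] (λ v → classify v ∘ there) P∩R[T])

module _ {A : Set} (_≟_ : DecidableEquality A) where

  open import Data.List.Membership.DecPropositional _≟_ using (_∈?_)

  multiplicity : A → List A → ℕ
  multiplicity v xs = length (filter (v ≟_) xs)

  multiplicity-++ : ∀ v xs ys → multiplicity v (xs ++ ys) ≡ multiplicity v xs + multiplicity v ys
  multiplicity-++ v xs ys = trans (cong length (filter-++ (v ≟_) xs ys)) (length-++ (filter (v ≟_) xs))

  unique⇒indicator≡multiplicity : ∀ v {xs} → Unique xs → indicator (v ∈? xs) ≡ multiplicity v xs
  unique⇒indicator≡multiplicity v {[]}     _        = refl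
  unique⇒indicator≡multiplicity v {x ∷ xs} (x∉ ∷ u) = by-cases (v ≟ x)
    where
    by-cases : Dec (v ≡ x) → indicator (v ∈? x ∷ xs) ≡ multiplicity v (x ∷ xs)
    by-cases (yes refl) = begin
      indicator (v ∈? x ∷ xs)   ≡⟨ indicator-yes (v ∈? x ∷ xs) (here refl) ⟩
      1                         ≡⟨ cong suc (indicator-no (v ∈? xs) (λ v∈ → All.lookup x∉ v∈ refl)) ⟨
      suc (indicator (v ∈? xs)) ≡⟨ cong suc (unique⇒indicator≡multiplicity v u) ⟩
      suc (multiplicity v xs)   ≡⟨ cong length (filter-accept (v ≟_) refl) ⟨
      multiplicity v (x ∷ xs)   ∎
      where open ≡-Reasoning
    by-cases (no v≢x) = begin
      indicator (v ∈? x ∷ xs) ≡⟨ indicator-cong (v ∈? x ∷ xs) (v ∈? xs) (mk⇔ drop-head there) ⟩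
      indicator (v ∈? xs)     ≡⟨ unique⇒indicator≡multiplicity v u ⟩
      multiplicity v xs       ≡⟨ cong length (filter-reject (v ≟_) v≢x) ⟨
      multiplicity v (x ∷ xs) ∎
      where
      open ≡-Reasoning
      drop-head : v ∈ x ∷ xs → v ∈ xs
      drop-head (here v≡x) = contradiction v≡x v≢x
      drop-head (there v∈) = v∈

  exchange-indicators : ∀ v p₁ m₁ s₁ p₂ m₂ s₂ →
    Unique (p₁ ++ m₁ ++ s₁) → Unique (p₂ ++ m₂ ++ s₂) →
    Unique (p₁ ++ m₂ ++ s₁) → Unique (p₂ ++ m₁ ++ s₂) →
    indicator (v ∈? p₁ ++ m₂ ++ s₁) + indicator (v ∈? p₂ ++ m₁ ++ s₂) ≡
    indicator (v ∈? p₁ ++ m₁ ++ s₁) + indicator (v ∈? p₂ ++ m₂ ++ s₂)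
  exchange-indicators v p₁ m₁ s₁ p₂ m₂ s₂ u₁ u₂ u₁′ u₂′ = begin
    indicator (v ∈? p₁ ++ m₂ ++ s₁) + indicator (v ∈? p₂ ++ m₁ ++ s₂)
      ≡⟨ cong₂ _+_ (split₃ p₁ m₂ s₁ u₁′) (split₃ p₂ m₁ s₂ u₂′) ⟩
    (# p₁ + (# m₂ + # s₁)) + (# p₂ + (# m₁ + # s₂))
      ≡⟨ solve 6 (λ a b c d e f → (a :+ (e :+ c)) :+ (d :+ (b :+ f)) := (a :+ (b :+ c)) :+ (d :+ (e :+ f)))
               refl (# p₁) (# m₁) (# s₁) (# p₂) (# m₂) (# s₂) ⟩
    (# p₁ + (# m₁ + # s₁)) + (# p₂ + (# m₂ + # s₂))
      ≡⟨ cong₂ _+_ (split₃ p₁ m₁ s₁ u₁) (split₃ p₂ m₂ s₂ u₂) ⟨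
    indicator (v ∈? p₁ ++ m₁ ++ s₁) + indicator (v ∈? p₂ ++ m₂ ++ s₂) ∎
    where
    open ≡-Reasoning
    open +-*-Solver
    # : List A → ℕ
    # = multiplicity v
    split₃ : ∀ xs ys zs → Unique (xs ++ ys ++ zs) →
      indicator (v ∈? xs ++ ys ++ zs) ≡ # xs + (# ys + # zs)
    split₃ xs ys zs u = trans (unique⇒indicator≡multiplicity v u)
      (trans (multiplicity-++ v xs (ys ++ zs)) (cong (# xs +_) (multiplicity-++ v ys zs)))

unique-++⁻ˡ : ∀ {A : Set} (xs : List A) {ys} → Unique (xs ++ ys) → Unique xs
unique-++⁻ˡ []       _        = []
unique-++⁻ˡ (x ∷ xs) (x∉ ∷ u) = ++⁻ˡ xs x∉ ∷ unique-++⁻ˡ xs u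

-- Walks

module Walks (G : Digraph) where

  infix 4 _⇝_
  _⇝_ : V G → V G → Set
  _⇝_ = Star (E G)

  consecutive-tail : ∀ {x L} → Consecutive G (x ∷ L) → Consecutive G L
  consecutive-tail {L = []}    _       = tt
  consecutive-tail {L = _ ∷ _} (_ , c) = c

  consecutive-++⁻ˡ : ∀ xs {ys} → Consecutive G (xs ++ ys) → Consecutive G xs
  consecutive-++⁻ˡ []           _       = tt
  consecutive-++⁻ˡ (x ∷ [])     _       = tt
  consecutive-++⁻ˡ (x ∷ y ∷ xs) (e , c) = e , consecutive-++⁻ˡ (y ∷ xs) c

  IsWalk : List (V G) → V G → V G → Set
  IsWalk L s t = Consecutive G L × FirstIs L s × LastIs L t

  walk-++ : ∀ {P Q s u t} → IsWalk P s u → IsWalk (u ∷ Q) u t → IsWalk (P ++ Q) s t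
  walk-++ {x ∷ []}    (_ , refl , refl) w = w
  walk-++ {x ∷ y ∷ P} ((e , c) , refl , l) w
    with c′ , _ , l′ ← walk-++ {y ∷ P} (c , refl , l) w = (e , c′) , refl , l′

  walk-split : ∀ P {Q s u t} → LastIs P u → IsWalk (P ++ Q) s t → IsWalk P s u × IsWalk (u ∷ Q) u t
  walk-split (x ∷ [])    refl (c , f , l)      = (tt , f , refl) , (c , refl , l)
  walk-split (x ∷ y ∷ P) lP   ((e , c) , f , l)
    with (c₁ , _ , l₁) , w₂ ← walk-split (y ∷ P) lP (c , refl , l) = ((e , c₁) , f , l₁) , w₂

  walk⇒⇝ : ∀ {L s t} → IsWalk L s t → s ⇝ t
  walk⇒⇝ {x ∷ []}    (_ , refl , refl)    = ε
  walk⇒⇝ {x ∷ y ∷ L} ((e , c) , refl , l) = e ◅ walk⇒⇝ (c , refl , l)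

  ⇝⇒walk : ∀ {s t} → s ⇝ t → ∃ λ L → IsWalk (s ∷ L) s t
  ⇝⇒walk ε       = [] , tt , refl , refl
  ⇝⇒walk (e ◅ p) with L , c , refl , l ← ⇝⇒walk p = _ ∷ L , (e , c) , refl , l

  walk-⇝-∈ : ∀ {L s t v} → IsWalk L s t → v ∈ L → s ⇝ v × v ⇝ t
  walk-⇝-∈ {v = v} walk v∈L with ys , zs , refl ← ∈-∃++ v∈L
    with w₁ , w₂ ← walk-split (ys ++ [ v ]) (last-∷ʳ ys v)
                     (subst (λ L → IsWalk L _ _) (sym (++-assoc ys [ v ] zs)) walk)
    = walk⇒⇝ w₁ , walk⇒⇝ w₂

  segment-walks : ∀ {L s t u w} → IsWalk L s t → (σ : Segment L u w) →
    IsWalk (pre σ ++ [ u ]) s u × IsWalk (middle σ) u w × IsWalk (w ∷ post σ) w t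
  segment-walks {u = u} walk σ
    with w₁ , w₂ ← walk-split (pre σ ++ [ u ]) (last-∷ʳ (pre σ) u)
                     (subst (λ L → IsWalk L _ _) (trans (split σ) (sym (++-assoc (pre σ) [ u ] _))) walk)
    with w₃ , w₄ ← walk-split (middle σ) (ends σ) w₂
    = w₁ , w₃ , w₄

  replace-middle : ∀ {L s t u w} N → IsWalk L s t → (σ : Segment L u w) → IsWalk (u ∷ N) u w →
    IsWalk (pre σ ++ (u ∷ N) ++ post σ) s t
  replace-middle {u = u} N walk σ walk-N with w₁ , _ , w₃ ← segment-walks walk σ =
    subst (λ L → IsWalk L _ _) (++-assoc (pre σ) [ u ] (N ++ post σ)) (walk-++ w₁ (walk-++ walk-N w₃))

  segment-⇝ : ∀ {L s t u w} → IsWalk L s t → Segment L u w → u ⇝ w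
  segment-⇝ walk σ = walk⇒⇝ (proj₁ (proj₂ (segment-walks walk σ)))

  segment-pre-⇝ : ∀ {L s t u w v} → IsWalk L s t → (σ : Segment L u w) → v ∈ pre σ → v ⇝ u
  segment-pre-⇝ walk σ v∈ = proj₂ (walk-⇝-∈ (proj₁ (segment-walks walk σ)) (∈-++⁺ˡ v∈))

  segment-middle-⇝ : ∀ {L s t u w v} → IsWalk L s t → (σ : Segment L u w) → v ∈ middle σ →
    u ⇝ v × v ⇝ w
  segment-middle-⇝ walk σ = walk-⇝-∈ (proj₁ (proj₂ (segment-walks walk σ)))

  segment-post-⇝ : ∀ {L s t u w v} → IsWalk L s t → (σ : Segment L u w) → v ∈ post σ → w ⇝ v
  segment-post-⇝ walk σ v∈ = proj₁ (walk-⇝-∈ (proj₂ (proj₂ (segment-walks walk σ))) (there v∈))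

module AcyclicWalks (G : Digraph) (acyclic : Acyclic G) where

  open Walks G
  open import Data.List.Membership.DecPropositional (_≟_ {n G}) using (_∈?_)

  consecutive-unique : ∀ {L} → Consecutive G L → Unique L
  consecutive-unique {[]}    _ = []
  consecutive-unique {x ∷ L} c with consecutive-unique (consecutive-tail c) | x ∈? L
  ... | u | no x∉L = ¬Any⇒All¬ L x∉L ∷ u
  ... | u | yes x∈L with ys , zs , refl ← ∈-∃++ x∈L = contradiction (cycle ys c u) acyclic
    where
    cycle : ∀ ys {zs} → Consecutive G (x ∷ ys ++ x ∷ zs) → Unique (ys ++ x ∷ zs) → HasCycle G
    cycle []        (e , _) _ = contradiction e (noLoop G x)
    cycle (y ∷ ys′) {zs} (e , c) u =
      C , y , x ,
      (unique-++⁻ˡ C (subst Unique assoc u) , consecutive-++⁻ˡ C (subst (Consecutive G) assoc c)) ,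
      s≤s (subst (1 ≤_) (sym (length-++ ys′)) (m≤n+m 1 _)) , refl , last-∷ʳ (y ∷ ys′) x , e
      where
      C : List (V G)
      C = y ∷ ys′ ++ [ x ]
      assoc : y ∷ ys′ ++ x ∷ zs ≡ C ++ zs
      assoc = cong (y ∷_) (sym (++-assoc ys′ [ x ] zs))

  walk⇒links : ∀ {L s t} → IsWalk L s t → Links G L s t
  walk⇒links (c , f , l) = (consecutive-unique c , c) , f , l

  no-closed-walk : ∀ {x y} → E G x y → y ⇝ x → ⊥
  no-closed-walk {x} e q with L , c , refl , l ← ⇝⇒walk q
    with x∉ ∷ _ ← consecutive-unique {x ∷ _ ∷ L} (e , c) = All.lookup x∉ (last-∈ l) refl

  ⇝-antisym : ∀ {x y} → x ⇝ y → y ⇝ x → x ≡ y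
  ⇝-antisym ε       _ = refl
  ⇝-antisym (e ◅ p) q = contradiction (p ◅◅ q) (no-closed-walk e)

  segment-toward : ∀ {L s t u w} → IsWalk L s t → u ∈ L → w ∈ L → u ⇝ w → Segment L u w
  segment-toward walk u∈ w∈ u⇝w with segment-or-reverse u∈ w∈
  ... | inj₁ σ = σ
  ... | inj₂ σ with refl ← ⇝-antisym u⇝w (segment-⇝ walk σ) = σ

-- Routings

≤∸1 : ∀ {m n} → suc m ≤ n → m ≤ n ∸ 1
≤∸1 (s≤s m≤n) = m≤n

suc[n∸1]≤n : ∀ {n} → 0 < n → suc (n ∸ 1) ≤ n
suc[n∸1]≤n (s≤s _) = ≤-refl

module Routings (G : Digraph) where

  open import Data.List.Membership.DecPropositional (_≟_ {n G}) using (_∈?_)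

  load≡∑ : ∀ {m} (P : Fin m → List (V G)) v → load G P v ≡ sum (λ i → indicator (v ∈? P i))
  load≡∑ P v = length-filter-tabulate (λ i → v ∈? P i) id

  routing-mono : ∀ {m c c′} {I : Fin m → V G × V G} → c ≤ c′ → Routing G I c → Routing G I c′
  routing-mono c≤c′ (P , links , bounded) = P , links , λ v → ≤-trans (bounded v) c≤c′

  routing-∷ : ∀ {m c} {I : Fin (suc m) → V G × V G} →
    PathExists G (proj₁ (I zero)) (proj₂ (I zero)) → Routing G (I ∘ suc) c → Routing G I (suc c)
  routing-∷ {m} {c} {I} (p , p-links) (P , links , bounded) = P′ , links′ , bounded′
    where
    P′ : Fin (suc m) → List (V G)
    P′ = p Vector.∷ P
    links′ : ∀ i → Links G (P′ i) (proj₁ (I i)) (proj₂ (I i))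
    links′ zero    = p-links
    links′ (suc i) = links i
    bounded′ : ∀ v → load G P′ v ≤ suc c
    bounded′ v = begin
      load G P′ v
        ≡⟨ load≡∑ P′ v ⟩
      indicator (v ∈? p) + sum (λ i → indicator (v ∈? P i))
        ≡⟨ cong (indicator (v ∈? p) +_) (load≡∑ P v) ⟨
      indicator (v ∈? p) + load G P v
        ≤⟨ +-mono-≤ (indicator≤1 (v ∈? p)) (bounded v) ⟩
      suc c ∎
      where open ≤-Reasoning

  routing-permute : ∀ {m c} {I : Fin m → V G × V G} (π : Permutation′ m) →
    Routing G (I ∘ (π ⟨$⟩ʳ_)) c → Routing G I c
  routing-permute {m} {c} {I} π (P , links , bounded) = P ∘ (π ⟨$⟩ˡ_) , links′ , bounded′
    where
    links′ : ∀ i → Links G (P (π ⟨$⟩ˡ i)) (proj₁ (I i)) (proj₂ (I i))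
    links′ i = subst (λ j → Links G (P (π ⟨$⟩ˡ i)) (proj₁ (I j)) (proj₂ (I j)))
                     (inverseʳ π) (links (π ⟨$⟩ˡ i))
    count : Fin m → V G → ℕ
    count x v = indicator (v ∈? P x)
    bounded′ : ∀ v → load G (P ∘ (π ⟨$⟩ˡ_)) v ≤ c
    bounded′ v = subst (_≤ c) (begin
      load G P v
        ≡⟨ load≡∑ P v ⟩
      sum (λ x → count x v)
        ≡⟨ sum-cong-≗ {m} (λ x → cong (λ y → count y v) (inverseˡ π)) ⟨
      sum (λ x → count (π ⟨$⟩ˡ (π ⟨$⟩ʳ x)) v)
        ≡⟨ sum-permute (λ i → count (π ⟨$⟩ˡ i) v) π ⟨
      sum (λ i → count (π ⟨$⟩ˡ i) v)
        ≡⟨ load≡∑ (P ∘ (π ⟨$⟩ˡ_)) v ⟨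
      load G (P ∘ (π ⟨$⟩ˡ_)) v ∎) (bounded v)
      where open ≡-Reasoning

  routing-removeAt : ∀ {m c} {I : Fin (suc m) → V G × V G} ((P , _ , _) : Routing G I c) (j : Fin (suc m)) →
    (∀ v → c ≤ load G P v → v ∈ P j) → Routing G (I ∘ punchIn j) (c ∸ 1)
  routing-removeAt {c = c} (P , links , bounded) j full⇒on-j = P ∘ punchIn j , links ∘ punchIn j , bounded′
    where
    bounded′ : ∀ v → load G (P ∘ punchIn j) v ≤ c ∸ 1
    bounded′ v = ≤∸1 (below (v ∈? P j))
      where
      rest : ℕ
      rest = load G (P ∘ punchIn j) v
      load-split : load G P v ≡ indicator (v ∈? P j) + rest
      load-split = trans (load≡∑ P v) (trans (sum-remove {i = j} (λ i → indicator (v ∈? P i)))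
                                              (cong (_ +_) (sym (load≡∑ (P ∘ punchIn j) v))))
      below : Dec (v ∈ P j) → suc rest ≤ c
      below (yes v∈) = subst (_≤ c) (trans load-split (cong (_+ rest) (indicator-yes (v ∈? P j) v∈)))
                         (bounded v)
      below (no v∉)  = subst (_< c) (trans load-split (cong (_+ rest) (indicator-no (v ∈? P j) v∉)))
                         (≰⇒> (v∉ ∘ full⇒on-j v))

-- Heavy vertices

module HeavyVertices (G : Digraph) (acyclic : Acyclic G) {k} (I : Fin k → V G × V G)
  (ℓ : V G → ℕ) (thr : ℕ) (few-paths : k * 2 < thr + thr + thr) where

  open import Data.List.Membership.DecPropositional (_≟_ {n G}) using (_∈?_)
  open Walks G
  open AcyclicWalks G acyclic
  open Routings G

  Heavy : V G → Set
  Heavy v = thr ≤ ℓ v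

  heavy? : Decidable Heavy
  heavy? v = thr ≤? ℓ v

  record Rerouting : Set where
    field
      path  : Fin k → List (V G)
      links : ∀ i → Links G (path i) (proj₁ (I i)) (proj₂ (I i))
      load≡ : ∀ v → load G path v ≡ ℓ v

    path-walk : ∀ i → IsWalk (path i) (proj₁ (I i)) (proj₂ (I i))
    path-walk i = let (_ , c) , f , l = links i in c , f , l

  open Rerouting

  module _ (ρ : Rerouting) where

    on-common-path : ∀ {a b c} → Heavy a → Heavy b → Heavy c →
      ∃ λ i → a ∈ path ρ i × b ∈ path ρ i × c ∈ path ρ i
    on-common-path {a} {b} {c} ha hb hc =
      let i , 2<count = ∑-pigeonhole 2 (λ i → count a i + count b i + count c i) many
      in  i , indicators>2⇒all (a ∈? path ρ i) (b ∈? path ρ i) (c ∈? path ρ i) 2<count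
      where
      count : V G → Fin k → ℕ
      count v i = indicator (v ∈? path ρ i)
      heavy-count : ∀ {v} → Heavy v → thr ≤ sum (count v)
      heavy-count {v} hv = subst (thr ≤_) (trans (sym (load≡ ρ v)) (load≡∑ (path ρ) v)) hv
      total : sum (λ i → count a i + count b i + count c i) ≡ sum (count a) + sum (count b) + sum (count c)
      total = trans (∑-distrib-+ (λ i → count a i + count b i) (count c))
                    (cong (_+ sum (count c)) (∑-distrib-+ (count a) (count b)))
      many : k * 2 < sum (λ i → count a i + count b i + count c i)
      many = <-≤-trans few-paths (subst (thr + thr + thr ≤_) (sym total)
        (+-mono-≤ (+-mono-≤ (heavy-count ha) (heavy-count hb)) (heavy-count hc)))

    heavy-comparable : ∀ {a b} → Heavy a → Heavy b → a ⇝ b ⊎ b ⇝ a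
    heavy-comparable ha hb with i , a∈ , b∈ , _ ← on-common-path ha hb hb with segment-or-reverse a∈ b∈
    ... | inj₁ σ = inj₁ (segment-⇝ (path-walk ρ i) σ)
    ... | inj₂ σ = inj₂ (segment-⇝ (path-walk ρ i) σ)

  module Exchange (ρ : Rerouting) {c b} (c≢b : c ≢ b) {u w}
                  (σ : Segment (path ρ c) u w) (τ : Segment (path ρ b) u w) where

    path′ : Fin k → List (V G)
    path′ = updateAt (updateAt (path ρ) c (const (pre σ ++ middle τ ++ post σ)))
                     b (const (pre τ ++ middle σ ++ post τ))

    path′-c : path′ c ≡ pre σ ++ middle τ ++ post σ
    path′-c = trans (updateAt-minimal c b _ c≢b) (updateAt-updates c (path ρ))

    path′-b : path′ b ≡ pre τ ++ middle σ ++ post τ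
    path′-b = updateAt-updates b _

    path′-other : ∀ {i} → i ≢ c → i ≢ b → path′ i ≡ path ρ i
    path′-other i≢c i≢b = trans (updateAt-minimal _ b _ i≢b) (updateAt-minimal _ c (path ρ) i≢c)

    walk-c : IsWalk (pre σ ++ middle τ ++ post σ) (proj₁ (I c)) (proj₂ (I c))
    walk-c = replace-middle (inner τ) (path-walk ρ c) σ (proj₁ (proj₂ (segment-walks (path-walk ρ b) τ)))

    walk-b : IsWalk (pre τ ++ middle σ ++ post τ) (proj₁ (I b)) (proj₂ (I b))
    walk-b = replace-middle (inner σ) (path-walk ρ b) τ (proj₁ (proj₂ (segment-walks (path-walk ρ c) σ)))

    links′ : ∀ i → Links G (path′ i) (proj₁ (I i)) (proj₂ (I i))
    links′ i with i ≟ c | i ≟ b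
    ... | yes refl | _        = subst (λ L → Links G L _ _) (sym path′-c) (walk⇒links walk-c)
    ... | no _     | yes refl = subst (λ L → Links G L _ _) (sym path′-b) (walk⇒links walk-b)
    ... | no i≢c   | no i≢b   = subst (λ L → Links G L _ _) (sym (path′-other i≢c i≢b)) (links ρ i)

    load′ : ∀ v → load G path′ v ≡ ℓ v
    load′ v = begin
      load G path′ v
        ≡⟨ load≡∑ path′ v ⟩
      sum (λ i → count (path′ i))
        ≡⟨ ∑-cong-outside-pair c≢b (λ i i≢c i≢b → cong count (path′-other i≢c i≢b)) pair ⟩
      sum (λ i → count (path ρ i))
        ≡⟨ load≡∑ (path ρ) v ⟨
      load G (path ρ) v
        ≡⟨ load≡ ρ v ⟩
      ℓ v ∎
      where
      open ≡-Reasoning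
      count : List (V G) → ℕ
      count L = indicator (v ∈? L)
      unique : ∀ {L s t} → IsWalk L s t → Unique L
      unique walk = consecutive-unique (proj₁ walk)
      pair : count (path′ c) + count (path′ b) ≡ count (path ρ c) + count (path ρ b)
      pair = begin
        count (path′ c) + count (path′ b)
          ≡⟨ cong₂ _+_ (cong count path′-c) (cong count path′-b) ⟩
        count (pre σ ++ middle τ ++ post σ) + count (pre τ ++ middle σ ++ post τ)
          ≡⟨ exchange-indicators _≟_ v (pre σ) (middle σ) (post σ) (pre τ) (middle τ) (post τ)
               (subst Unique (split σ) (unique (path-walk ρ c)))
               (subst Unique (split τ) (unique (path-walk ρ b)))
               (unique walk-c) (unique walk-b) ⟩
        count (pre σ ++ middle σ ++ post σ) + count (pre τ ++ middle τ ++ post τ)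
          ≡⟨ cong₂ _+_ (cong count (split σ)) (cong count (split τ)) ⟨
        count (path ρ c) + count (path ρ b) ∎

    exchanged : Rerouting
    exchanged = record { path = path′ ; links = links′ ; load≡ = load′ }

  Enlargement : Rerouting → Fin k → V G → Set
  Enlargement ρ c h = Σ Rerouting λ ρ′ → Σ (Fin k) λ c′ →
    (∀ v → Heavy v → v ∈ path ρ c → v ∈ path ρ′ c′) × h ∈ path ρ′ c′

  module Enlarge (ρ : Rerouting) (c : Fin k) {h} (heavy-h : Heavy h) (h∉c : h ∉ path ρ c) where

    off-c : ∀ {v} → v ∈ path ρ c → v ⇝ h → h ⇝ v → ⊥
    off-c v∈c v⇝h h⇝v = h∉c (subst (_∈ path ρ c) (⇝-antisym v⇝h h⇝v) v∈c)

    carrying : ∀ {b} → h ∈ path ρ b → c ≢ b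
    carrying h∈b refl = h∉c h∈b

    absorb : ∀ {b w w′} → h ∈ path ρ b → (σ : Segment (path ρ c) w w′) (τ : Segment (path ρ b) w w′) →
      All (¬_ ∘ Heavy) (pre σ) → All (¬_ ∘ Heavy) (post σ) → h ∈ pre τ ⊎ h ∈ post τ →
      Enlargement ρ c h
    absorb {b} h∈b σ τ light-pre light-post h-outside =
      exchanged , b , carried , subst (h ∈_) (sym path′-b) h∈b′
      where
      open Exchange ρ (carrying h∈b) σ τ
      h∈b′ : h ∈ pre τ ++ middle σ ++ post τ
      h∈b′ = [ ∈-++⁺ˡ , ∈-++⁺ʳ (pre τ) ∘ ∈-++⁺ʳ (middle σ) ]′ h-outside
      carried : ∀ v → Heavy v → v ∈ path ρ c → v ∈ path′ b
      carried v hv v∈c with ∈-segment⁻ σ v∈c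
      ... | inj₁ v∈pre         = contradiction hv (All.lookup light-pre v∈pre)
      ... | inj₂ (inj₁ v∈mid)  = subst (v ∈_) (sym path′-b) (∈-++-middle⁺ (pre τ) v∈mid)
      ... | inj₂ (inj₂ v∈post) = contradiction hv (All.lookup light-post v∈post)

    Gap : Set
    Gap = Crossing heavy? {Q = _⇝ h} {R = h ⇝_} (path ρ c)

    find-gap : ∀ {w w′} (σ : Segment (path ρ c) w w′) → Heavy w → Heavy w′ → w ⇝ h → h ⇝ w′ → Gap
    find-gap {w} σ hw hw′ w⇝h h⇝w′ = subst (Crossing heavy?) (sym (split σ))
      (crossing-prepend heavy? (pre σ)
        (crossing heavy? w [] (inner σ ++ post σ) hw w⇝h [] classify w′-later))
      where
      classify : ∀ v → v ∈ inner σ ++ post σ → Heavy v → v ⇝ h ⊎ h ⇝ v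
      classify v _ hv = heavy-comparable ρ hv heavy-h
      w′-later : Any (λ z → Heavy z × h ⇝ z) (inner σ ++ post σ)
      w′-later with last-∈ {xs = middle σ} (ends σ)
      ... | here refl = contradiction h⇝w′ (off-c (∈-middle⁺ σ (here refl)) w⇝h)
      ... | there w′∈ = lose (∈-++⁺ˡ w′∈) (hw′ , h⇝w′)

    close-gap : Gap → Enlargement ρ c h
    close-gap (x , y , γ , hx , hy , x⇝h , h⇝y , only-ends) with on-common-path ρ hx heavy-h hy
    ... | b , x∈b , h∈b , y∈b =
      exchanged , c , carried , subst (h ∈_) (sym path′-c) (∈-++-middle⁺ (pre γ) h∈τ)
      where
      τ : Segment (path ρ b) x y
      τ = segment-toward (path-walk ρ b) x∈b y∈b (x⇝h ◅◅ h⇝y)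
      h∈τ : h ∈ middle τ
      h∈τ with ∈-segment⁻ τ h∈b
      ... | inj₁ h∈pre         = contradiction (segment-pre-⇝ (path-walk ρ b) τ h∈pre)
                                                 (off-c (∈-middle⁺ γ (here refl)) x⇝h)
      ... | inj₂ (inj₁ h∈mid)  = h∈mid
      ... | inj₂ (inj₂ h∈post) = contradiction h⇝y (off-c (∈-middle⁺ γ (last-∈ (ends γ)))
                                                           (segment-post-⇝ (path-walk ρ b) τ h∈post))
      open Exchange ρ (carrying h∈b) γ τ
      carried : ∀ v → Heavy v → v ∈ path ρ c → v ∈ path′ c
      carried v hv v∈c =
        subst (v ∈_) (sym path′-c) (∈-++-replace-middle (pre γ) (subst (v ∈_) (split γ) v∈c) endpoint)
        where
        endpoint : v ∈ middle γ → v ∈ middle τ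
        endpoint v∈γ with only-ends v v∈γ hv
        ... | inj₁ refl = here refl
        ... | inj₂ refl = last-∈ (ends τ)

    enlarge : Enlargement ρ c h
    enlarge with Any.any? heavy? (path ρ c)
    ... | no no-heavy = let i , h∈i , _ = on-common-path ρ heavy-h heavy-h heavy-h
                        in  ρ , i , (λ v hv v∈c → contradiction (lose v∈c hv) no-heavy) , h∈i
    ... | yes some-heavy with outermost-segment heavy? some-heavy
    ... | w , w′ , σ , hw , hw′ , light-pre , light-post with on-common-path ρ heavy-h hw hw′
    ... | b , h∈b , w∈b , w′∈b
      with τ ← segment-toward (path-walk ρ b) w∈b w′∈b (segment-⇝ (path-walk ρ c) σ)
      with ∈-segment⁻ τ h∈b
    ... | inj₁ h∈pre         = absorb h∈b σ τ light-pre light-post (inj₁ h∈pre)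
    ... | inj₂ (inj₂ h∈post) = absorb h∈b σ τ light-pre light-post (inj₂ h∈post)
    ... | inj₂ (inj₁ h∈mid)  = let w⇝h , h⇝w′ = segment-middle-⇝ (path-walk ρ b) τ h∈mid
                               in  close-gap (find-gap σ hw hw′ w⇝h h⇝w′)

  open Enlarge using (enlarge)

  gather-heavy : Rerouting → Fin k → (vs : List (V G)) →
    Σ Rerouting λ ρ → Σ (Fin k) λ c → ∀ v → v ∈ vs → Heavy v → v ∈ path ρ c
  gather-heavy ρ c []       = ρ , c , λ _ ()
  gather-heavy ρ c (u ∷ vs) with gather-heavy ρ c vs
  ... | ρ′ , c′ , covered with heavy? u
  ...   | no light =
    ρ′ , c′ , λ { v (here refl) hv → contradiction hv light ; v (there v∈) hv → covered v v∈ hv }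
  ...   | yes hu with u ∈? path ρ′ c′
  ...     | yes u∈ = ρ′ , c′ , λ { v (here refl) _ → u∈ ; v (there v∈) hv → covered v v∈ hv }
  ...     | no u∉ with ρ″ , c″ , carried , u∈ ← enlarge ρ′ c′ hu u∉ =
    ρ″ , c″ , λ { v (here refl) _ → u∈ ; v (there v∈) hv → carried v hv (covered v v∈ hv) }

  all-heavy-on-one-path : Rerouting → Fin k →
    Σ Rerouting λ ρ → Σ (Fin k) λ c → ∀ v → Heavy v → v ∈ path ρ c
  all-heavy-on-one-path ρ c with ρ′ , c′ , covered ← gather-heavy ρ c (allFin (n G)) =
    ρ′ , c′ , λ v → covered v (∈-allFin v)

full-vertices-on-one-path : ∀ {G} → Acyclic G → ∀ {k c} {I : Fin (suc k) → V G × V G} →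
  suc k * 2 < c + c + c → (R : Routing G I c) →
  Σ (Routing G I c) λ R′ → Σ (Fin (suc k)) λ j → ∀ v → c ≤ load G (proj₁ R′) v → v ∈ proj₁ R′ j
full-vertices-on-one-path {G} acyclic {c = c} {I} few-paths (P , P-links , bounded) =
  let ρ , j , covered = all-heavy-on-one-path ρ₀ zero
  in  (path ρ , links ρ , λ v → subst (_≤ c) (sym (load≡ ρ v)) (bounded v)) , j ,
      λ v full → covered v (subst (c ≤_) (load≡ ρ v) full)
  where
  open HeavyVertices G acyclic I (load G P) c few-paths
  open Rerouting
  ρ₀ : Rerouting
  ρ₀ = record { path = P ; links = P-links ; load≡ = λ _ → refl }

few-paths : ∀ {d k} → 3 * d < k → k * 2 < (k ∸ d) + (k ∸ d) + (k ∸ d)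
few-paths {d} {k} 3d<k =
  subst (λ k → k * 2 < t + t + t) t+d≡k (subst (_< t + t + t) (sym e) (+-monoʳ-< (t + t) 2d<t))
  where
  open +-*-Solver
  t : ℕ
  t = k ∸ d
  t+d≡k : t + d ≡ k
  t+d≡k = m∸n+n≡m (≤-trans (m≤n*m d 3) (<⇒≤ 3d<k))
  2d<t : d + d < t
  2d<t = +-cancelʳ-< d (d + d) t
    (subst₂ _<_ (solve 1 (λ d → con 3 :* d := d :+ d :+ d) refl d) (sym t+d≡k) 3d<k)
  e : (t + d) * 2 ≡ t + t + (d + d)
  e = solve 2 (λ t d → (t :+ d) :* con 2 := t :+ t :+ (d :+ d)) refl t d

lemma6 : (G : Digraph) → Acyclic G → (d k : ℕ) → 1 ≤ d → 3 * d < k →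
    (I : Fin k → V G × V G) → Injective _≡_ _≡_ I →
    Routing G I (k ∸ d) ⇔
      ((∀ i → PathExists G (proj₁ (I i)) (proj₂ (I i)))
       × Σ (Fin (k ∸ 1) → Fin k) λ f → Injective _≡_ _≡_ f
           × Routing G (I ∘ f) (k ∸ d ∸ 1))
lemma6 G acyclic d zero    _ () I _
lemma6 G acyclic d (suc m) _ 3d<k I _ = mk⇔ forward backward
  where
  open Routings G
  Reduced : Set
  Reduced = (∀ i → PathExists G (proj₁ (I i)) (proj₂ (I i)))
            × Σ (Fin m → Fin (suc m)) λ f → Injective _≡_ _≡_ f × Routing G (I ∘ f) (suc m ∸ d ∸ 1)
  forward : Routing G I (suc m ∸ d) → Reduced
  forward R@(P , P-links , _) =
    let R′ , j , full⇒on-j = full-vertices-on-one-path acyclic (few-paths {d} 3d<k) R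
    in  (λ i → P i , P-links i) , punchIn j , (λ {x} {y} → punchIn-injective j x y) ,
        routing-removeAt R′ j full⇒on-j
  backward : Reduced → Routing G I (suc m ∸ d)
  backward (paths , f , f-inj , Q) =
    let j , missed = missed-point f-inj
    in  routing-permute (injective⇒permutation (j Vector.∷ f) (cons-injective missed f-inj))
          (routing-mono (suc[n∸1]≤n (m<n⇒0<n∸m (≤-<-trans (m≤n*m d 3) 3d<k))) (routing-∷ (paths j) Q))
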